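{- Let $n\ge1$, $s\ge0$ be integers, let $a_j=\binom{n+s-j}{n-j}$ for $0\le j\le n$, let $b_0,\dots,b_n$ be integers with $|b_0|=|b_n|=1$, and let $G(x)=\sum_{j=0}^n b_ja_j\frac{x^j}{j!}$. Assume $G(x)$ has a factor of degree $2$ over $\mathbb{Q}$. Let $\delta\in\{0,1\}$, let $r>0$ be an integer and let $p>2$ be a prime with $p^r\mid (n-\delta)$. If $\delta=1$, assume moreover that $\gcd(s+1,p)=1$. Then $s\ge p^r-\delta$.
   Context: Factors are taken in $\mathbb{Q}[x]$. -}

module Defs where

open import Data.Nat using (ℕ; zero; suc; _∸_; _≤_; _<_; _!)
open import Data.Nat.Properties using (_!≢0; _<?_)
open import Data.Nat.Combinatorics using (_C_)
open import Data.Integer using (ℤ; +_)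
import Data.Integer as ℤ
open import Data.Rational using (ℚ; 0ℚ; _+_; _*_; _/_)
open import Relation.Nullary using (yes; no; ¬_)
open import Relation.Binary.PropositionalEquality using (_≡_)
open import Data.Product using (Σ; ∃; _×_)

-- A polynomial over ℚ, represented by its coefficient function
-- (coefficient of x^k), required to have finite support.
Coeffs : Set
Coeffs = ℕ → ℚ

FinSupp : Coeffs → Set
FinSupp f = Σ ℕ λ d → ∀ k → d < k → f k ≡ 0ℚ

sumTo : ℕ → (ℕ → ℚ) → ℚ
sumTo zero    f = f 0
sumTo (suc k) f = sumTo k f + f (suc k)

mulCoeff : Coeffs → Coeffs → Coeffs
mulCoeff A B k = sumTo k (λ i → A i * B (k ∸ i))

HasDegree2 : Coeffs → Set
HasDegree2 A = (¬ (A 2 ≡ 0ℚ)) × (∀ k → 2 < k → A k ≡ 0ℚ)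

Divides : Coeffs → Coeffs → Set
Divides A G = Σ Coeffs λ B → FinSupp B × (∀ k → mulCoeff A B k ≡ G k)

HasQuadFactor : Coeffs → Set
HasQuadFactor G = Σ Coeffs λ A → HasDegree2 A × Divides A G

aCoeff : ℕ → ℕ → ℕ → ℕ
aCoeff n s j = (n Data.Nat.+ s ∸ j) C (n ∸ j)

Gpoly : ℕ → ℕ → (ℕ → ℤ) → Coeffs
Gpoly n s b j with j <? suc n
... | yes _ = ((b j ℤ.* + aCoeff n s j) / (j !)) {{j !≢0}}
... | no _  = 0ℚ

-- Multiply G by n! and clear denominators, so that a quadratic factor of G yields a factorisation
-- c = A · B over ℤ with deg A = 2, where c_j = b_j a_j n!/j! = b_j a_j (j+1)⋯n.  Consider the
-- p-adic Newton polygon of c.  Its right end point (n, ν c_n) is lowest since |b_n| = 1; every c_k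
-- with k ≤ n − 2 is divisible by p, since the product (k+1)⋯n contains n − δ.  If s < p^r − δ,
-- adding s to n − δ ≡ 0 (mod p^r) produces no carries, so p ∤ a_0 and ν c_0 = ν(n!); together with
-- 2 ν(k!) < k for p ≥ 3 this puts every point (k, ν c_k), k ≥ 1, strictly above the line of slope
-- −1/2 through (0, ν c_0).  By Gauss' lemma for weighted valuations, for every weight k ν + m i the
-- product of the extremal coefficients of A and B is the extremal coefficient of c.  Applied to the
-- three shapes above this puts the ν-minimal coefficients of A at index 2 and, for the earliest one,
-- away from index 0, while the slope −1/2 forces ν A_0 ≤ ν A_2: a contradiction.

module Submission where

open import Defs
open import Data.Nat using (ℕ; _+_; _∸_; _^_; _≤_; _<_; _≥_)
open import Data.Nat.Divisibility using (_∣_)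
open import Data.Nat.GCD using (gcd; gcd-greatest)
open import Data.Nat.Primality using (Prime)
open import Data.Integer using (ℤ; ∣_∣)
open import Relation.Binary.PropositionalEquality using (_≡_)

open import Data.Nat using (zero; suc; pred; _*_; _!; z≤n; s≤s; NonZero; ≢-nonZero; ≢-nonZero⁻¹; nonTrivial⇒n>1)
open import Data.Nat.Properties
open import Data.Nat.Divisibility
  using (divides; _∤_; _∣?_; ∣-trans; ∣-refl; ∣⇒≤; m∣m*n; n∣m*n; ∣m⇒∣m*n; ∣n⇒∣m*n; ∣m∣n⇒∣m+n; ∣m+n∣m⇒∣n)
open import Data.Nat.Divisibility using (∣1⇒≡1; 1∣_; _∣0; 0∣⇒≡0; *-pres-∣)
open import Data.Nat.Induction using (<-rec)
open import Data.Nat.DivMod using (_/_; _%_; m/n*n≡m; m%n<n; m≡m%n+[m/n]*n)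
open import Data.Nat.Combinatorics using (_C_; k![n∸k]!∣n!)
open import Data.Nat.Combinatorics.Specification using (nCk≡n!/k![n-k]!)
open import Data.Nat.Primality using (euclidsLemma; prime⇒nonZero; prime⇒nonTrivial)
import Data.Nat.Coprimality as Coprime
open import Data.Integer using (0ℤ; +_)
import Data.Integer as ℤ
import Data.Integer.Properties as ℤ
import Data.Integer.Divisibility.Signed as ℤ∣
open ℤ∣ using () renaming (_∣_ to _∣ℤ_)
open import Data.Rational using (ℚ; mkℚ; 0ℚ; 1ℚ; ↥_; ↧ₙ_; toℚᵘ)
import Data.Rational as ℚ
import Data.Rational.Properties as ℚ
import Data.Rational.Unnormalised as ℚᵘ
import Data.Rational.Unnormalised.Properties as ℚᵘ
import Data.Nat.Solver
import Data.Integer.Solver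
import Data.Rational.Solver
open import Data.Product using (∃-syntax; _×_; _,_; proj₁; proj₂)
open import Data.Sum using (_⊎_; inj₁; inj₂; [_,_]; [_,_]′)
open import Data.Empty using (⊥; ⊥-elim)
open import Function using (_∘_; case_of_)
open import Relation.Nullary using (¬_; ¬?; yes; no)
open import Relation.Unary using (Decidable)
open import Relation.Binary.Definitions using (tri<; tri≈; tri>)
open import Relation.Binary.PropositionalEquality using (_≢_; refl; sym; trans; cong; cong₂; subst; subst₂; module ≡-Reasoning)

module ℕS = Data.Nat.Solver.+-*-Solver
module ℤS = Data.Integer.Solver.+-*-Solver
module ℚS = Data.Rational.Solver.+-*-Solver

≤-suc-cases : ∀ {i d} → i ≤ suc d → i ≡ suc d ⊎ i ≤ d
≤-suc-cases {i} {d} i≤ with i ≟ suc d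
... | yes i≡ = inj₁ i≡
... | no i≢ = inj₂ (≤-pred (≤∧≢⇒< i≤ i≢))

!-≢0 : ∀ n → n ! ≢ 0
!-≢0 n = ≢-nonZero⁻¹ (n !) {{n !≢0}}

*-≢0ℕ : ∀ {m n} → m ≢ 0 → n ≢ 0 → m * n ≢ 0
*-≢0ℕ {m} m≢0 n≢0 mn≡0 = [ m≢0 , n≢0 ]′ (m*n≡0⇒m≡0∨n≡0 m mn≡0)

-- p-adic valuation

module Valuation {p : ℕ} (p-prime : Prime p) where

  instance
    p≢0 : NonZero p
    p≢0 = prime⇒nonZero p-prime

  1<p : 1 < p
  1<p = nonTrivial⇒n>1 p {{prime⇒nonTrivial p-prime}}

  ^-monoʳ-∣ : ∀ {a b} → a ≤ b → p ^ a ∣ p ^ b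
  ^-monoʳ-∣ {a} {b} a≤b = divides (p ^ (b ∸ a))
    (trans (cong (p ^_) (sym (m∸n+n≡m a≤b))) (^-distribˡ-+-* p (b ∸ a) a))

  infix 4 p^_∥_

  record p^_∥_ (e m : ℕ) : Set where
    constructor exactly
    field
      cofactor     : ℕ
      factorises   : m ≡ cofactor * p ^ e
      ∤-cofactor   : p ∤ cofactor

  ∥⇒∣ : ∀ {e m} → p^ e ∥ m → p ^ e ∣ m
  ∥⇒∣ (exactly u m≡ _) = divides u m≡

  ∥⇒∤ : ∀ {e m} → p^ e ∥ m → p ^ suc e ∤ m
  ∥⇒∤ {e} (exactly u m≡ p∤u) (divides w m≡′) = p∤u (divides w (*-cancelʳ-≡ u (w * p) (p ^ e) {{m^n≢0 p e}}
    (trans (sym m≡) (trans m≡′ (sym (*-assoc w p (p ^ e)))))))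

  ∣∧∤⇒∥ : ∀ {e m} → p ^ e ∣ m → p ^ suc e ∤ m → p^ e ∥ m
  ∣∧∤⇒∥ {e} (divides u m≡) ∤m = exactly u m≡ λ { (divides w u≡) →
    ∤m (divides w (trans m≡ (trans (cong (_* p ^ e) u≡) (*-assoc w p (p ^ e))))) }

  ∥⇒≢0 : ∀ {e m} → p^ e ∥ m → m ≢ 0
  ∥⇒≢0 {e} ∥m refl = ∥⇒∤ ∥m (divides 0 refl)

  ∥-greatest : ∀ {e m t} → p^ e ∥ m → p ^ t ∣ m → t ≤ e
  ∥-greatest {e} {t = t} ∥m p^t∣m with t ≤? e
  ... | yes t≤e = t≤e
  ... | no t≰e = ⊥-elim (∥⇒∤ ∥m (∣-trans (^-monoʳ-∣ (≰⇒> t≰e)) p^t∣m))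

  ∥-unique : ∀ {e f m} → p^ e ∥ m → p^ f ∥ m → e ≡ f
  ∥-unique ∥m ∥m′ = ≤-antisym (∥-greatest ∥m′ (∥⇒∣ ∥m)) (∥-greatest ∥m (∥⇒∣ ∥m′))

  ∥-* : ∀ {e f a b} → p^ e ∥ a → p^ f ∥ b → p^ (e + f) ∥ a * b
  ∥-* {e} {f} {a} {b} (exactly u a≡ p∤u) (exactly w b≡ p∤w) =
    exactly (u * w) ab≡ λ p∣uw → [ p∤u , p∤w ] (euclidsLemma u w p-prime p∣uw)
    where
    ab≡ : a * b ≡ u * w * p ^ (e + f)
    ab≡ = begin
      a * b                     ≡⟨ cong₂ _*_ a≡ b≡ ⟩
      u * p ^ e * (w * p ^ f)   ≡⟨ solve 4 (λ U W X Y → U :* X :* (W :* Y) := U :* W :* (X :* Y)) refl u w (p ^ e) (p ^ f) ⟩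
      u * w * (p ^ e * p ^ f)   ≡⟨ cong (u * w *_) (^-distribˡ-+-* p e f) ⟨
      u * w * p ^ (e + f)       ∎
      where
      open ≡-Reasoning
      open ℕS

  ∥-+ : ∀ {e x y} → p^ e ∥ x → p ^ suc e ∣ y → p^ e ∥ y + x
  ∥-+ {e} ∥x p^e+1∣y = ∣∧∤⇒∥ (∣m∣n⇒∣m+n (∣-trans (^-monoʳ-∣ (n≤1+n e)) p^e+1∣y) (∥⇒∣ ∥x))
                              (λ p^e+1∣y+x → ∥⇒∤ ∥x (∣m+n∣m⇒∣n p^e+1∣y+x p^e+1∣y))

  ∥-exists : ∀ m → m ≢ 0 → ∃[ e ] p^ e ∥ m
  ∥-exists = <-rec (λ m → m ≢ 0 → ∃[ e ] p^ e ∥ m) step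
    where
    step : ∀ m → (∀ {q} → q < m → q ≢ 0 → ∃[ e ] p^ e ∥ q) → m ≢ 0 → ∃[ e ] p^ e ∥ m
    step m rec m≢0 with p ∣? m
    ... | no p∤m = 0 , exactly m (sym (*-identityʳ m)) p∤m
    ... | yes (divides q m≡) with rec q<m q≢0
      where
      q≢0 : q ≢ 0
      q≢0 refl = m≢0 m≡
      q<m : q < m
      q<m = subst (q <_) (sym m≡) (m<m*n q p {{≢-nonZero q≢0}} 1<p)
    ... | e , exactly u q≡ p∤u = suc e , exactly u m≡′ p∤u
      where
      m≡′ : m ≡ u * p ^ suc e
      m≡′ = trans m≡ (trans (cong (_* p) q≡)
        (solve 3 (λ U X P → U :* X :* P := U :* (P :* X)) refl u (p ^ e) p))
        where open ℕS

  -- ν 0 = 0 is a junk value.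
  ν : ℕ → ℕ
  ν m with m ≟ 0
  ... | yes _ = 0
  ... | no m≢0 = proj₁ (∥-exists m m≢0)

  ν-∥ : ∀ {m} → m ≢ 0 → p^ ν m ∥ m
  ν-∥ {m} m≢0 with m ≟ 0
  ... | yes m≡0 = ⊥-elim (m≢0 m≡0)
  ... | no m≢0′ = proj₂ (∥-exists m m≢0′)

  ν-unique : ∀ {e m} → p^ e ∥ m → ν m ≡ e
  ν-unique ∥m = ∥-unique (ν-∥ (∥⇒≢0 ∥m)) ∥m

  ν-greatest : ∀ {m t} → m ≢ 0 → p ^ t ∣ m → t ≤ ν m
  ν-greatest m≢0 = ∥-greatest (ν-∥ m≢0)

  ν-* : ∀ {a b} → a ≢ 0 → b ≢ 0 → ν (a * b) ≡ ν a + ν b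
  ν-* a≢0 b≢0 = ν-unique (∥-* (ν-∥ a≢0) (ν-∥ b≢0))

  ν-∤ : ∀ {m} → p ∤ m → ν m ≡ 0
  ν-∤ {m} p∤m = ν-unique (exactly m (sym (*-identityʳ m)) p∤m)

  ∣⇒ν≤ : ∀ {d m} → m ≢ 0 → d ∣ m → ν d ≤ ν m
  ∣⇒ν≤ {d} m≢0 d∣m = ν-greatest m≢0 (∣-trans (∥⇒∣ (ν-∥ d≢0)) d∣m)
    where
    d≢0 : d ≢ 0
    d≢0 refl = m≢0 (0∣⇒≡0 d∣m)

  p∤1 : p ∤ 1
  p∤1 p∣1 = <⇒≢ 1<p (sym (∣1⇒≡1 p∣1))

  ν-1 : ν 1 ≡ 0
  ν-1 = ν-∤ p∤1

  ν-p : ν p ≡ 1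
  ν-p = ν-unique (exactly 1 (sym (trans (*-identityˡ (p * 1)) (*-identityʳ p))) p∤1)

  ν-p* : ∀ {m} → m ≢ 0 → ν (p * m) ≡ suc (ν m)
  ν-p* {m} m≢0 = trans (ν-* (≢-nonZero⁻¹ p) m≢0) (cong (_+ ν m) ν-p)

  gcd≡1⇒∤ : ∀ {m} → gcd m p ≡ 1 → p ∤ m
  gcd≡1⇒∤ gcd≡1 p∣m = p∤1 (subst (p ∣_) gcd≡1 (gcd-greatest p∣m ∣-refl))

-- Factorials and binomial coefficients

rising : ℕ → ℕ → ℕ
rising k zero    = 1
rising k (suc t) = rising k t * (k + suc t)

!*rising≡! : ∀ k t → k ! * rising k t ≡ (k + t) !
!*rising≡! k zero = trans (*-identityʳ (k !)) (cong _! (sym (+-identityʳ k)))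
!*rising≡! k (suc t) = begin
  k ! * (rising k t * (k + suc t))  ≡⟨ *-assoc (k !) (rising k t) (k + suc t) ⟨
  k ! * rising k t * (k + suc t)    ≡⟨ cong (_* (k + suc t)) (!*rising≡! k t) ⟩
  (k + t) ! * (k + suc t)           ≡⟨ *-comm ((k + t) !) (k + suc t) ⟩
  (k + suc t) * (k + t) !           ≡⟨ cong (λ m → m * (k + t) !) (+-suc k t) ⟩
  suc (k + t) !                     ≡⟨ cong _! (+-suc k t) ⟨
  (k + suc t) !                     ∎
  where open ≡-Reasoning

rising≢0 : ∀ k t → rising k t ≢ 0
rising≢0 k t r≡0 = !-≢0 (k + t) (trans (sym (!*rising≡! k t)) (trans (cong (k ! *_) r≡0) (*-zeroʳ (k !))))

+∣rising : ∀ k {t u} → 1 ≤ u → u ≤ t → k + u ∣ rising k t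
+∣rising k {zero} () z≤n
+∣rising k {suc t} 1≤u u≤1+t with ≤-suc-cases u≤1+t
... | inj₁ refl = n∣m*n (rising k t)
... | inj₂ u≤t = ∣m⇒∣m*n (k + suc t) (+∣rising k 1≤u u≤t)

C*!*!≡! : ∀ n s → ((n + s) C n) * (n ! * s !) ≡ (n + s) !
C*!*!≡! n s = trans (cong₂ _*_ (nCk≡n!/k![n-k]! n≤n+s) (cong (λ m → n ! * m !) (sym (m+n∸m≡n n s))))
                    (m/n*n≡m {{n !* (n + s ∸ n) !≢0}} (k![n∸k]!∣n! n≤n+s))
  where n≤n+s = m≤m+n n s

C*!≡rising : ∀ n s → ((n + s) C n) * s ! ≡ rising n s
C*!≡rising n s = *-cancelˡ-≡ (((n + s) C n) * s !) (rising n s) (n !) {{n !≢0}} (begin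
  n ! * (((n + s) C n) * s !)   ≡⟨ solve 3 (λ a x b → a :* (x :* b) := x :* (a :* b)) refl (n !) ((n + s) C n) (s !) ⟩
  ((n + s) C n) * (n ! * s !)   ≡⟨ C*!*!≡! n s ⟩
  (n + s) !                   ≡⟨ !*rising≡! n s ⟨
  n ! * rising n s            ∎)
  where
  open ≡-Reasoning
  open ℕS

module FactorialValuation {p : ℕ} (p-prime : Prime p) where
  open Valuation p-prime

  ν-+-multiple : ∀ {r N x} → p ^ r ∣ N → 1 ≤ x → x < p ^ r → ν (N + x) ≡ ν x
  ν-+-multiple {r} {N} {x} p^r∣N 1≤x x<p^r = ν-unique (∥-+ ∥x (∣-trans (^-monoʳ-∣ ν<r) p^r∣N))
    where
    x≢0 = <⇒≢ 1≤x ∘ sym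
    ∥x = ν-∥ x≢0
    ν<r : ν x < r
    ν<r = ≰⇒> λ r≤ν → <⇒≱ x<p^r (≤-trans (^-monoʳ-≤ p r≤ν) (∣⇒≤ {{≢-nonZero x≢0}} (∥⇒∣ ∥x)))

  ν-suc-! : ∀ k → ν (suc k !) ≡ ν (suc k) + ν (k !)
  ν-suc-! k = ν-* 1+n≢0 (!-≢0 k)

  ν-!-digit : ∀ q r → r < p → ν ((p * q + r) !) ≡ ν ((p * q) !)
  ν-!-digit q zero _ = cong (ν ∘ _!) (+-identityʳ (p * q))
  ν-!-digit q (suc r) 1+r<p = begin
    ν ((p * q + suc r) !)                   ≡⟨ cong (ν ∘ _!) (+-suc (p * q) r) ⟩
    ν (suc (p * q + r) !)                   ≡⟨ ν-suc-! (p * q + r) ⟩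
    ν (suc (p * q + r)) + ν ((p * q + r) !) ≡⟨ cong (_+ ν ((p * q + r) !)) (ν-∤ p∤) ⟩
    ν ((p * q + r) !)                       ≡⟨ ν-!-digit q r (<⇒≤ 1+r<p) ⟩
    ν ((p * q) !)                           ∎
    where
    open ≡-Reasoning
    p∤ : p ∤ suc (p * q + r)
    p∤ p∣ = <⇒≱ 1+r<p (∣⇒≤ (∣m+n∣m⇒∣n (subst (p ∣_) (sym (+-suc (p * q) r)) p∣) (m∣m*n q)))

  pred[p]<p : pred p < p
  pred[p]<p = m≤pred[n]⇒suc[m]≤n ≤-refl

  p*[1+q]≡ : ∀ q → p * suc q ≡ suc (p * q + pred p)
  p*[1+q]≡ q = begin
    p * suc q               ≡⟨ *-suc p q ⟩
    p + p * q               ≡⟨ +-comm p (p * q) ⟩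
    p * q + p               ≡⟨ cong (λ m → p * q + m) (suc-pred p) ⟨
    p * q + suc (pred p)    ≡⟨ +-suc (p * q) (pred p) ⟩
    suc (p * q + pred p)    ∎
    where open ≡-Reasoning

  ν-p*-! : ∀ q → ν ((p * q) !) ≡ q + ν (q !)
  ν-p*-! zero = cong (ν ∘ _!) (*-zeroʳ p)
  ν-p*-! (suc q) = begin
    ν ((p * suc q) !)                                ≡⟨ cong (ν ∘ _!) (p*[1+q]≡ q) ⟩
    ν (suc (p * q + pred p) !)                       ≡⟨ ν-suc-! (p * q + pred p) ⟩
    ν (suc (p * q + pred p)) + ν ((p * q + pred p) !) ≡⟨ cong₂ _+_ (cong ν (sym (p*[1+q]≡ q))) (ν-!-digit q (pred p) pred[p]<p) ⟩
    ν (p * suc q) + ν ((p * q) !)                    ≡⟨ cong₂ _+_ (ν-p* 1+n≢0) (ν-p*-! q) ⟩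
    suc (ν (suc q)) + (q + ν (q !))                  ≡⟨ solve 3 (λ a b c → (con 1 :+ a) :+ (b :+ c) := (con 1 :+ b) :+ (a :+ c))
                                                                refl (ν (suc q)) q (ν (q !)) ⟩
    suc q + (ν (suc q) + ν (q !))                    ≡⟨ cong (λ m → suc q + m) (ν-suc-! q) ⟨
    suc q + ν (suc q !)                              ∎
    where
    open ≡-Reasoning
    open ℕS

  ν-!-legendre : ∀ q r → r < p → ν ((p * q + r) !) ≡ q + ν (q !)
  ν-!-legendre q r r<p = trans (ν-!-digit q r r<p) (ν-p*-! q)

  2*ν-!< : 3 ≤ p → ∀ k → 1 ≤ k → 2 * ν (k !) < k
  2*ν-!< 3≤p = <-rec (λ k → 1 ≤ k → 2 * ν (k !) < k) step
    where
    step : ∀ k → (∀ {q} → q < k → 1 ≤ q → 2 * ν (q !) < q) → 1 ≤ k → 2 * ν (k !) < k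
    step k rec 1≤k = subst (λ v → 2 * v < k) (sym ν-k!) (bound (k / p) k≡)
      where
      k≡ : k ≡ p * (k / p) + k % p
      k≡ = trans (m≡m%n+[m/n]*n k p) (trans (+-comm (k % p) _) (cong (_+ k % p) (*-comm (k / p) p)))
      ν-k! : ν (k !) ≡ k / p + ν ((k / p) !)
      ν-k! = trans (cong (ν ∘ _!) k≡) (ν-!-legendre (k / p) (k % p) (m%n<n k p))
      bound : ∀ q → k ≡ p * q + k % p → 2 * (q + ν (q !)) < k
      bound zero _ = subst (λ v → 2 * v < k) (sym ν-1) 1≤k
      bound (suc q) k≡′ = begin-strict
        2 * (suc q + ν (suc q !))        ≡⟨ *-distribˡ-+ 2 (suc q) (ν (suc q !)) ⟩
        2 * suc q + 2 * ν (suc q !)      <⟨ +-monoʳ-< (2 * suc q) (rec q<k (s≤s z≤n)) ⟩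
        2 * suc q + suc q                ≡⟨ +-comm (2 * suc q) (suc q) ⟩
        3 * suc q                        ≤⟨ *-monoˡ-≤ (suc q) 3≤p ⟩
        p * suc q                        ≤⟨ m≤m+n (p * suc q) (k % p) ⟩
        p * suc q + k % p                ≡⟨ k≡′ ⟨
        k                                ∎
        where
        open ≤-Reasoning
        q<k : suc q < k
        q<k = <-≤-trans (subst (suc q <_) (*-comm (suc q) p) (m<m*n (suc q) p 1<p))
                        (subst (p * suc q ≤_) (sym k≡′) (m≤m+n (p * suc q) (k % p)))

  ν-rising-shift : ∀ {r N} → p ^ r ∣ N → ∀ c s → c + s < p ^ r → ν (rising (N + c) s) ≡ ν (rising c s)
  ν-rising-shift p^r∣N c zero _ = refl
  ν-rising-shift {r} {N} p^r∣N c (suc s) c+s<p^r = begin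
    ν (rising (N + c) s * (N + c + suc s))     ≡⟨ ν-* (rising≢0 (N + c) s) (m+1+n≢0 (N + c)) ⟩
    ν (rising (N + c) s) + ν (N + c + suc s)   ≡⟨ cong₂ _+_ (ν-rising-shift {r} p^r∣N c s (≤-trans (s≤s (+-monoʳ-≤ c (n≤1+n s))) c+s<p^r))
                                                            (trans (cong ν (+-assoc N c (suc s))) (ν-+-multiple {r} p^r∣N 1≤ c+s<p^r)) ⟩
    ν (rising c s) + ν (c + suc s)             ≡⟨ ν-* (rising≢0 c s) (m+1+n≢0 c) ⟨
    ν (rising c s * (c + suc s))               ∎
    where
    open ≡-Reasoning
    1≤ : 1 ≤ c + suc s
    1≤ = subst (1 ≤_) (sym (+-suc c s)) (s≤s z≤n)

  ν-rising-δ : ∀ δ s → δ ≤ 1 → (δ ≡ 1 → p ∤ suc s) → ν (rising δ s) ≡ ν (s !)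
  ν-rising-δ 0 s z≤n _ = cong ν (trans (sym (+-identityʳ (rising 0 s))) (!*rising≡! 0 s))
  ν-rising-δ 1 s (s≤s z≤n) p∤1+s = begin
    ν (rising 1 s)          ≡⟨ cong ν (trans (sym (+-identityʳ (rising 1 s))) (!*rising≡! 1 s)) ⟩
    ν (suc s !)             ≡⟨ ν-suc-! s ⟩
    ν (suc s) + ν (s !)     ≡⟨ cong (_+ ν (s !)) (ν-∤ (p∤1+s refl)) ⟩
    ν (s !)                 ∎
    where open ≡-Reasoning

  -- Since p ^ r ∣ N and δ + s < p ^ r, the factors N + δ + i of (N+δ+s)!/(N+δ)! have the valuations
  -- of δ + i: there are no carries.
  ∤-binomial : ∀ {r N} δ s → p ^ r ∣ N → δ ≤ 1 → s + δ < p ^ r → (δ ≡ 1 → p ∤ suc s) →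
               p ∤ (N + δ + s) C (N + δ)
  ∤-binomial {r} {N} δ s p^r∣N δ≤1 s+δ<p^r p∤1+s p∣X = <⇒≢ (ν-greatest X≢0 p^1∣X) (sym ν-X≡0)
    where
    X = (N + δ + s) C (N + δ)
    X≢0 : X ≢ 0
    X≢0 X≡0 = rising≢0 (N + δ) s (trans (sym (C*!≡rising (N + δ) s)) (cong (_* s !) X≡0))
    p^1∣X : p ^ 1 ∣ X
    p^1∣X = subst (_∣ X) (sym (*-identityʳ p)) p∣X
    ν-X≡0 : ν X ≡ 0
    ν-X≡0 = +-cancelʳ-≡ (ν (s !)) (ν X) 0 (begin
      ν X + ν (s !)                ≡⟨ ν-* X≢0 (!-≢0 s) ⟨
      ν (X * s !)                  ≡⟨ cong ν (C*!≡rising (N + δ) s) ⟩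
      ν (rising (N + δ) s)         ≡⟨ ν-rising-shift {r} p^r∣N δ s (subst (_< p ^ r) (+-comm s δ) s+δ<p^r) ⟩
      ν (rising δ s)               ≡⟨ ν-rising-δ δ s δ≤1 p∤1+s ⟩
      ν (s !)                      ∎)
      where open ≡-Reasoning

-- Integer polynomials

sumToℤ : ℕ → (ℕ → ℤ) → ℤ
sumToℤ zero    f = f 0
sumToℤ (suc k) f = sumToℤ k f ℤ.+ f (suc k)

mulCoeffℤ : (ℕ → ℤ) → (ℕ → ℤ) → ℕ → ℤ
mulCoeffℤ A B k = sumToℤ k (λ i → A i ℤ.* B (k ∸ i))

VanishesAbove : ℕ → (ℕ → ℤ) → Set
VanishesAbove d f = ∀ k → d < k → f k ≡ 0ℤ

∣-sumToℤ : ∀ {d} k f → (∀ i → i ≤ k → d ∣ℤ f i) → d ∣ℤ sumToℤ k f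
∣-sumToℤ zero    f d∣f = d∣f 0 z≤n
∣-sumToℤ (suc k) f d∣f =
  ℤ∣.∣m∣n⇒∣m+n (∣-sumToℤ k f (λ i i≤k → d∣f i (m≤n⇒m≤1+n i≤k))) (d∣f (suc k) ≤-refl)

∣-sumToℤ-except : ∀ {d} k f {i} → i ≤ k → (∀ j → j ≤ k → j ≢ i → d ∣ℤ f j) →
                  d ∣ℤ sumToℤ k f ℤ.- f i
∣-sumToℤ-except {d} zero f z≤n _ = subst (d ∣ℤ_) (sym (ℤ.+-inverseʳ (f 0))) (ℤ∣.divides 0ℤ (sym (ℤ.*-zeroˡ d)))
∣-sumToℤ-except {d} (suc k) f {i} i≤ d∣f with ≤-suc-cases i≤
... | inj₁ refl = subst (d ∣ℤ_) (sym (ℤS.solve 2 (λ a b → (a :+ b) :- b := a) refl (sumToℤ k f) (f i)))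
  (∣-sumToℤ k f (λ j j≤k → d∣f j (m≤n⇒m≤1+n j≤k) (<⇒≢ (s≤s j≤k))))
  where open ℤS
... | inj₂ i≤k = subst (d ∣ℤ_) (ℤS.solve 3 (λ a b c → (a :- c) :+ b := (a :+ b) :- c) refl (sumToℤ k f) (f (suc k)) (f i))
  (ℤ∣.∣m∣n⇒∣m+n (∣-sumToℤ-except k f i≤k (λ j j≤k → d∣f j (m≤n⇒m≤1+n j≤k)))
                (d∣f (suc k) ≤-refl (<⇒≢ (s≤s i≤k) ∘ sym)))
  where open ℤS

sumToℤ-single : ∀ k f {i} → i ≤ k → (∀ j → j ≤ k → j ≢ i → f j ≡ 0ℤ) → sumToℤ k f ≡ f i
sumToℤ-single k f i≤k f≡0 = ℤ.i-j≡0⇒i≡j _ _ (ℤ∣.0∣⇒≡0 (∣-sumToℤ-except k f i≤k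
  (λ j j≤k j≢i → subst (0ℤ ∣ℤ_) (sym (f≡0 j j≤k j≢i)) ℤ∣.∣-refl)))

sumToℤ-zero : ∀ k f → (∀ j → j ≤ k → f j ≡ 0ℤ) → sumToℤ k f ≡ 0ℤ
sumToℤ-zero k f f≡0 = trans (sumToℤ-single k f z≤n (λ j j≤k _ → f≡0 j j≤k)) (f≡0 0 z≤n)

product-vanishes : ∀ {a b} A B → VanishesAbove a A → VanishesAbove b B →
                   ∀ {i j} → a + b < i + j → A i ℤ.* B j ≡ 0ℤ
product-vanishes {a} {b} A B A↑ B↑ {i} {j} a+b<i+j with i ≤? a
... | yes i≤a = trans (cong (A i ℤ.*_) (B↑ j b<j)) (ℤ.*-zeroʳ (A i))
  where b<j = +-cancelˡ-< a b j (<-≤-trans a+b<i+j (+-monoˡ-≤ j i≤a))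
... | no i≰a = cong (ℤ._* B j) (A↑ i (≰⇒> i≰a))

mulCoeffℤ-above : ∀ {a b} A B → VanishesAbove a A → VanishesAbove b B →
                  VanishesAbove (a + b) (mulCoeffℤ A B)
mulCoeffℤ-above A B A↑ B↑ k a+b<k = sumToℤ-zero k _ term
  where
  term : ∀ j → j ≤ k → A j ℤ.* B (k ∸ j) ≡ 0ℤ
  term j j≤k = product-vanishes A B A↑ B↑ (subst (_ <_) (sym (m+[n∸m]≡n j≤k)) a+b<k)

mulCoeffℤ-top : ∀ {a b} A B → VanishesAbove a A → VanishesAbove b B →
                mulCoeffℤ A B (a + b) ≡ A a ℤ.* B b
mulCoeffℤ-top {a} {b} A B A↑ B↑ =
  trans (sumToℤ-single (a + b) _ (m≤m+n a b) term) (cong (λ j → A a ℤ.* B j) (m+n∸m≡n a b))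
  where
  term : ∀ j → j ≤ a + b → j ≢ a → A j ℤ.* B (a + b ∸ j) ≡ 0ℤ
  term j _ j≢a with <-cmp j a
  ... | tri< j<a _ _ = trans (cong (A j ℤ.*_) (B↑ _ b<)) (ℤ.*-zeroʳ (A j))
    where b< = subst (_< a + b ∸ j) (m+n∸m≡n a b) (∸-monoʳ-< j<a (m≤m+n a b))
  ... | tri≈ _ j≡a _ = ⊥-elim (j≢a j≡a)
  ... | tri> _ _ a<j = cong (ℤ._* B (a + b ∸ j)) (A↑ j a<j)

*-≢0ℤ : ∀ {x y} → x ≢ 0ℤ → y ≢ 0ℤ → x ℤ.* y ≢ 0ℤ
*-≢0ℤ {x} x≢0 y≢0 xy≡0 = [ x≢0 , y≢0 ]′ (ℤ.i*j≡0⇒i≡0∨j≡0 x xy≡0)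

≢0⇒≤ : ∀ {d f i} → VanishesAbove d f → f i ≢ 0ℤ → i ≤ d
≢0⇒≤ {d} {i = i} f↑ fi≢0 with i ≤? d
... | yes i≤d = i≤d
... | no i≰d = ⊥-elim (fi≢0 (f↑ i (≰⇒> i≰d)))

degree-exists : ∀ d f → VanishesAbove d f → (∀ k → f k ≡ 0ℤ) ⊎ ∃[ b ] f b ≢ 0ℤ × VanishesAbove b f
degree-exists zero f f↑ with f 0 ℤ.≟ 0ℤ
... | yes f0≡0 = inj₁ λ { zero → f0≡0 ; (suc k) → f↑ (suc k) (s≤s z≤n) }
... | no f0≢0 = inj₂ (0 , f0≢0 , f↑)
degree-exists (suc d) f f↑ with f (suc d) ℤ.≟ 0ℤ
... | no fd≢0 = inj₂ (suc d , fd≢0 , f↑)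
... | yes fd≡0 = degree-exists d f λ k d<k → [ f↑ k , (λ { refl → fd≡0 }) ]′ (m≤n⇒m<n∨m≡n d<k)

mulCoeffℤ-degree : ∀ {a b n} A B H → A a ≢ 0ℤ → VanishesAbove a A → B b ≢ 0ℤ → VanishesAbove b B →
                   (∀ k → mulCoeffℤ A B k ≡ H k) → H n ≢ 0ℤ → VanishesAbove n H → n ≡ a + b
mulCoeffℤ-degree {a} {b} {n} A B H Aa≢0 A↑ Bb≢0 B↑ AB≡H Hn≢0 H↑ = ≤-antisym
  (≢0⇒≤ (λ k a+b<k → trans (sym (AB≡H k)) (mulCoeffℤ-above A B A↑ B↑ k a+b<k)) Hn≢0)
  (≢0⇒≤ H↑ (λ H≡0 → *-≢0ℤ Aa≢0 Bb≢0 (trans (sym (mulCoeffℤ-top A B A↑ B↑)) (trans (AB≡H (a + b)) H≡0))))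

-- Newton polygons

record Least (_≺_ : ℕ → ℕ → Set) (P : ℕ → Set) : Set where
  field
    index : ℕ
    holds : P index
    least : ∀ {i} → P i → i ≡ index ⊎ index ≺ i

open Least

module LeastElements (_≺_ : ℕ → ℕ → Set)
                     (≺-trans : ∀ {i j k} → i ≺ j → j ≺ k → i ≺ k)
                     (≺-connex : ∀ {i j} → i ≢ j → i ≺ j ⊎ j ≺ i) where

  LeastUpTo : ℕ → (ℕ → Set) → Set
  LeastUpTo d P = Least _≺_ (λ i → i ≤ d × P i)

  module _ {P : ℕ → Set} {d : ℕ} where

    only-new : (∀ i → i ≤ d → ¬ P i) → P (suc d) → LeastUpTo (suc d) P
    only-new none Pd = record
      { index = suc d
      ; holds = ≤-refl , Pd
      ; least = λ { (i≤ , Pi) → [ inj₁ , (λ i≤d → ⊥-elim (none _ i≤d Pi)) ] (≤-suc-cases i≤) }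
      }

    keep : (L : LeastUpTo d P) → (P (suc d) → index L ≺ suc d) → LeastUpTo (suc d) P
    keep L L≺new = record
      { index = index L
      ; holds = m≤n⇒m≤1+n (proj₁ (holds L)) , proj₂ (holds L)
      ; least = λ { (i≤ , Pi) → [ (λ { refl → inj₂ (L≺new Pi) }) , (λ i≤d → least L (i≤d , Pi)) ] (≤-suc-cases i≤) }
      }

    replace : (L : LeastUpTo d P) → P (suc d) → suc d ≺ index L → LeastUpTo (suc d) P
    replace L Pd new≺L = record
      { index = suc d
      ; holds = ≤-refl , Pd
      ; least = λ { (i≤ , Pi) → [ inj₁ , (λ i≤d → inj₂ ([ (λ { refl → new≺L }) , ≺-trans new≺L ] (least L (i≤d , Pi)))) ]
                                  (≤-suc-cases i≤) }
      }

  least-≤ : ∀ {P : ℕ → Set} → Decidable P → ∀ d → (∀ i → i ≤ d → ¬ P i) ⊎ LeastUpTo d P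
  least-≤ P? zero with P? 0
  ... | no ¬P0 = inj₁ λ { .0 z≤n → ¬P0 }
  ... | yes P0 = inj₂ record { index = 0 ; holds = z≤n , P0 ; least = λ { (z≤n , _) → inj₁ refl } }
  least-≤ P? (suc d) with least-≤ P? d | P? (suc d)
  ... | inj₁ none | no ¬Pd = inj₁ λ i i≤ → [ (λ { refl → ¬Pd }) , none i ] (≤-suc-cases i≤)
  ... | inj₁ none | yes Pd = inj₂ (only-new none Pd)
  ... | inj₂ L    | no ¬Pd = inj₂ (keep L (λ Pd → ⊥-elim (¬Pd Pd)))
  ... | inj₂ L    | yes Pd = inj₂ ([ replace L Pd , (λ L≺new → keep L (λ _ → L≺new)) ]′
                                      (≺-connex (<⇒≢ (s≤s (proj₁ (holds L))) ∘ sym)))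

  least-exists : ∀ {P : ℕ → Set} → Decidable P → ∀ d → (∀ i → P i → i ≤ d) → ∀ {i} → P i → Least _≺_ P
  least-exists P? d bounded {i} Pi with least-≤ P? d
  ... | inj₁ none = ⊥-elim (none i (bounded i Pi) Pi)
  ... | inj₂ L = record
    { index = index L
    ; holds = proj₂ (holds L)
    ; least = λ Pj → least L (bounded _ Pj , Pj)
    }

-- Orders compatible with addition: of the index pairs with a given sum, at most one is ⊏-least on
-- both sides.
record TieBreak : Set₁ where
  field
    _⊏_      : ℕ → ℕ → Set
    ⊏-trans  : ∀ {i j k} → i ⊏ j → j ⊏ k → i ⊏ k
    ⊏-connex : ∀ {i j} → i ≢ j → i ⊏ j ⊎ j ⊏ i
    ⊏-+-≢    : ∀ {i i′ j j′} → i ⊏ i′ → j ⊏ j′ → i + j ≢ i′ + j′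

<-connex : ∀ {i j} → i ≢ j → i < j ⊎ j < i
<-connex {i} {j} i≢j with <-cmp i j
... | tri< i<j _ _ = inj₁ i<j
... | tri≈ _ i≡j _ = ⊥-elim (i≢j i≡j)
... | tri> _ _ j<i = inj₂ j<i

earliest latest : TieBreak
earliest = record
  { _⊏_ = _<_ ; ⊏-trans = <-trans ; ⊏-connex = <-connex
  ; ⊏-+-≢ = λ i<i′ j<j′ → <⇒≢ (+-mono-< i<i′ j<j′) }
latest = record
  { _⊏_ = λ i j → j < i ; ⊏-trans = λ j<i k<j → <-trans k<j j<i ; ⊏-connex = <-connex ∘ (_∘ sym)
  ; ⊏-+-≢ = λ i′<i j′<j → <⇒≢ (+-mono-< i′<i j′<j) ∘ sym }

module Extremal (tb : TieBreak) where
  open TieBreak tb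

  LexBy : (ℕ → ℕ) → ℕ → ℕ → Set
  LexBy w i j = w i < w j ⊎ (w i ≡ w j × i ⊏ j)

  lex⇒≤ : ∀ {w i j} → LexBy w i j → w i ≤ w j
  lex⇒≤ (inj₁ wi<wj) = <⇒≤ wi<wj
  lex⇒≤ (inj₂ (wi≡wj , _)) = ≤-reflexive wi≡wj

  lex⇒< : ∀ {w i j} → LexBy w i j → ¬ (i ⊏ j) → w i < w j
  lex⇒< (inj₁ wi<wj) _ = wi<wj
  lex⇒< (inj₂ (_ , i⊏j)) i⋢j = ⊥-elim (i⋢j i⊏j)

  lex-+ : ∀ {w w′ i i′ j j′} → LexBy w i i′ → LexBy w′ j j′ → i + j ≡ i′ + j′ → w i + w′ j < w i′ + w′ j′
  lex-+ (inj₁ <i) lj _ = +-mono-<-≤ <i (lex⇒≤ lj)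
  lex-+ (inj₂ (≡i , _)) (inj₁ <j) _ = +-mono-≤-< (≤-reflexive ≡i) <j
  lex-+ (inj₂ (_ , i⊏)) (inj₂ (_ , j⊏)) i+j≡ = ⊥-elim (⊏-+-≢ i⊏ j⊏ i+j≡)

  lex-trans : ∀ {w i j k} → LexBy w i j → LexBy w j k → LexBy w i k
  lex-trans (inj₁ <j) (inj₁ <k) = inj₁ (<-trans <j <k)
  lex-trans (inj₁ <j) (inj₂ (≡k , _)) = inj₁ (<-≤-trans <j (≤-reflexive ≡k))
  lex-trans (inj₂ (≡j , _)) (inj₁ <k) = inj₁ (≤-<-trans (≤-reflexive ≡j) <k)
  lex-trans (inj₂ (≡j , i⊏j)) (inj₂ (≡k , j⊏k)) = inj₂ (trans ≡j ≡k , ⊏-trans i⊏j j⊏k)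

  lex-connex : ∀ {w i j} → i ≢ j → LexBy w i j ⊎ LexBy w j i
  lex-connex {w} {i} {j} i≢j with <-cmp (w i) (w j)
  ... | tri< wi<wj _ _ = inj₁ (inj₁ wi<wj)
  ... | tri> _ _ wj<wi = inj₂ (inj₁ wj<wi)
  ... | tri≈ _ wi≡wj _ = [ (λ i⊏j → inj₁ (inj₂ (wi≡wj , i⊏j))) , (λ j⊏i → inj₂ (inj₂ (sym wi≡wj , j⊏i))) ]′ (⊏-connex i≢j)

  -- For the weight k ν + m i this is an end point of the edge of slope −m/k of the Newton polygon of f.
  ExtremalIndex : (ℕ → ℕ) → (ℕ → ℤ) → Set
  ExtremalIndex w f = Least (LexBy w) (λ i → f i ≢ 0ℤ)

  extremal-exists : ∀ w {d f} → VanishesAbove d f → ∀ {i} → f i ≢ 0ℤ → ExtremalIndex w f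
  extremal-exists w {d} {f} f↑ = LeastElements.least-exists (LexBy w) (lex-trans {w}) (lex-connex {w})
    (λ i → ¬? (f i ℤ.≟ 0ℤ)) d (λ _ → ≢0⇒≤ f↑)

  extremal-minimal : ∀ {w f i} (L : ExtremalIndex w f) → f i ≢ 0ℤ → w (index L) ≤ w i
  extremal-minimal {w} L fi≢0 = [ (λ i≡ → ≤-reflexive (cong w (sym i≡))) , lex⇒≤ ]′ (least L fi≢0)

  extremal-strict : ∀ {w f i} (L : ExtremalIndex w f) → f i ≢ 0ℤ → i ≢ index L → ¬ (index L ⊏ i) →
                    w (index L) < w i
  extremal-strict L fi≢0 i≢ L⋢i = [ (λ i≡ → ⊥-elim (i≢ i≡)) , (λ L≺i → lex⇒< L≺i L⋢i) ]′ (least L fi≢0)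

module Newton {p : ℕ} (p-prime : Prime p) where
  open Valuation p-prime

  νℤ : ℤ → ℕ
  νℤ x = ν ∣ x ∣

  i≢0⇒∣i∣≢0 : ∀ {x} → x ≢ 0ℤ → ∣ x ∣ ≢ 0
  i≢0⇒∣i∣≢0 x≢0 = x≢0 ∘ ℤ.∣i∣≡0⇒i≡0

  ∥-abs-* : ∀ {e f} x y → p^ e ∥ ∣ x ∣ → p^ f ∥ ∣ y ∣ → p^ (e + f) ∥ ∣ x ℤ.* y ∣
  ∥-abs-* {e} {f} x y ∥x ∥y = subst (p^ (e + f) ∥_) (sym (ℤ.abs-* x y)) (∥-* ∥x ∥y)

  νℤ-∥ : ∀ {x} → x ≢ 0ℤ → p^ νℤ x ∥ ∣ x ∣
  νℤ-∥ x≢0 = ν-∥ (i≢0⇒∣i∣≢0 x≢0)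

  νℤ-* : ∀ {x y} → x ≢ 0ℤ → y ≢ 0ℤ → νℤ (x ℤ.* y) ≡ νℤ x + νℤ y
  νℤ-* {x} {y} x≢0 y≢0 = ν-unique (∥-abs-* x y (νℤ-∥ x≢0) (νℤ-∥ y≢0))

  ∣ℤ-weaken : ∀ {t u x} → t ≤ u → + (p ^ u) ∣ℤ x → + (p ^ t) ∣ℤ x
  ∣ℤ-weaken t≤u = ℤ∣.∣-trans (ℤ∣.∣ᵤ⇒∣ (^-monoʳ-∣ t≤u))

  ≤νℤ⇒∣ : ∀ {t} x → (x ≢ 0ℤ → t ≤ νℤ x) → + (p ^ t) ∣ℤ x
  ≤νℤ⇒∣ {t} x t≤ν with x ℤ.≟ 0ℤ
  ... | yes refl = ℤ∣.divides 0ℤ refl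
  ... | no x≢0 = ∣ℤ-weaken (t≤ν x≢0) (ℤ∣.∣ᵤ⇒∣ (∥⇒∣ (νℤ-∥ x≢0)))

  ∥-abs-+ : ∀ {e} y z → p^ e ∥ ∣ y ∣ → + (p ^ suc e) ∣ℤ z → p^ e ∥ ∣ y ℤ.+ z ∣
  ∥-abs-+ {e} y z ∥y p^e+1∣z = ∣∧∤⇒∥ (ℤ∣.∣⇒∣ᵤ p^e∣y+z) (∥⇒∤ ∥y ∘ ℤ∣.∣⇒∣ᵤ ∘ p^e+1∣y ∘ ℤ∣.∣ᵤ⇒∣ {i = y ℤ.+ z})
    where
    p^e∣y+z : + (p ^ e) ∣ℤ y ℤ.+ z
    p^e∣y+z = ℤ∣.∣m∣n⇒∣m+n (ℤ∣.∣ᵤ⇒∣ {i = y} (∥⇒∣ ∥y)) (∣ℤ-weaken (n≤1+n e) p^e+1∣z)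
    p^e+1∣y : + (p ^ suc e) ∣ℤ y ℤ.+ z → + (p ^ suc e) ∣ℤ y
    p^e+1∣y p^e+1∣y+z = ℤ∣.∣m+n∣n⇒∣m p^e+1∣y+z p^e+1∣z

  mulCoeffℤ-∥ : ∀ A B {i₁ j₁} → A i₁ ≢ 0ℤ → B j₁ ≢ 0ℤ →
    (∀ {i j} → i + j ≡ i₁ + j₁ → i ≢ i₁ → A i ≢ 0ℤ → B j ≢ 0ℤ →
       νℤ (A i₁) + νℤ (B j₁) < νℤ (A i) + νℤ (B j)) →
    p^ (νℤ (A i₁) + νℤ (B j₁)) ∥ ∣ mulCoeffℤ A B (i₁ + j₁) ∣
  mulCoeffℤ-∥ A B {i₁} {j₁} Ai₁≢0 Bj₁≢0 dominant =
    subst (λ c → p^ e ∥ ∣ c ∣) (ℤS.solve 2 (λ c t → t :+ (c :- t) := c) refl (mulCoeffℤ A B K) (term i₁))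
      (∥-abs-+ (term i₁) _ ∥term-i₁ (∣-sumToℤ-except K term (m≤m+n i₁ j₁) ∣term))
    where
    open ℤS
    K = i₁ + j₁
    e = νℤ (A i₁) + νℤ (B j₁)
    term : ℕ → ℤ
    term i = A i ℤ.* B (K ∸ i)
    ∥term-i₁ : p^ e ∥ ∣ term i₁ ∣
    ∥term-i₁ = subst (λ j → p^ e ∥ ∣ A i₁ ℤ.* B j ∣) (sym (m+n∸m≡n i₁ j₁))
                 (∥-abs-* (A i₁) (B j₁) (νℤ-∥ Ai₁≢0) (νℤ-∥ Bj₁≢0))
    ∣term : ∀ i → i ≤ K → i ≢ i₁ → + (p ^ suc e) ∣ℤ term i
    ∣term i i≤K i≢i₁ = ≤νℤ⇒∣ (term i) λ term≢0 →
      let Ai≢0 = λ Ai≡0 → term≢0 (cong (ℤ._* B (K ∸ i)) Ai≡0)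
          Bj≢0 = λ Bj≡0 → term≢0 (trans (cong (A i ℤ.*_) Bj≡0) (ℤ.*-zeroʳ (A i)))
      in subst (e <_) (sym (νℤ-* Ai≢0 Bj≢0)) (dominant (m+[n∸m]≡n i≤K) i≢i₁ Ai≢0 Bj≢0)

  weight : ℕ → ℕ → (ℕ → ℤ) → ℕ → ℕ
  weight k m f i = k * νℤ (f i) + m * i

  weight-1-0 : ∀ f i → weight 1 0 f i ≡ νℤ (f i)
  weight-1-0 f i = trans (+-identityʳ _) (+-identityʳ _)

  weight-sum : ∀ k m a b i j → (k * a + m * i) + (k * b + m * j) ≡ k * (a + b) + m * (i + j)
  weight-sum = solve 6 (λ k m a b i j → (k :* a :+ m :* i) :+ (k :* b :+ m :* j) := k :* (a :+ b) :+ m :* (i :+ j)) refl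
    where open ℕS

  weight-sum-<⇒ : ∀ k m .{{_ : NonZero k}} {a b c d i j i′ j′} → i + j ≡ i′ + j′ →
                  (k * a + m * i) + (k * b + m * j) < (k * c + m * i′) + (k * d + m * j′) → a + b < c + d
  weight-sum-<⇒ k m {a} {b} {c} {d} {i} {j} {i′} {j′} i+j≡ lt =
    *-cancelˡ-< k (a + b) (c + d) (+-cancelʳ-< (m * (i + j)) (k * (a + b)) (k * (c + d))
      (subst₂ _<_ (weight-sum k m a b i j) (trans (weight-sum k m c d i′ j′) (cong (λ t → k * (c + d) + m * t) (sym i+j≡))) lt))

  extremal-∥ : ∀ tb k m .{{_ : NonZero k}} A B →
    (LA : Extremal.ExtremalIndex tb (weight k m A) A) (LB : Extremal.ExtremalIndex tb (weight k m B) B) →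
    p^ (νℤ (A (index LA)) + νℤ (B (index LB))) ∥ ∣ mulCoeffℤ A B (index LA + index LB) ∣
  extremal-∥ tb k m A B LA LB = mulCoeffℤ-∥ A B (holds LA) (holds LB) dominant
    where
    open Extremal tb
    dominant : ∀ {i j} → i + j ≡ index LA + index LB → i ≢ index LA → A i ≢ 0ℤ → B j ≢ 0ℤ →
               νℤ (A (index LA)) + νℤ (B (index LB)) < νℤ (A i) + νℤ (B j)
    dominant {i} i+j≡ i≢ Ai≢0 Bj≢0 with least LA Ai≢0 | least LB Bj≢0
    ... | inj₁ i≡ | _ = ⊥-elim (i≢ i≡)
    ... | inj₂ _ | inj₁ refl = ⊥-elim (i≢ (+-cancelʳ-≡ (index LB) i (index LA) i+j≡))
    ... | inj₂ LA≺i | inj₂ LB≺j = weight-sum-<⇒ k m (sym i+j≡) (lex-+ LA≺i LB≺j (sym i+j≡))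

  ν-extremal-minimal : ∀ tb {f i} (L : Extremal.ExtremalIndex tb (weight 1 0 f) f) → f i ≢ 0ℤ →
                       νℤ (f (index L)) ≤ νℤ (f i)
  ν-extremal-minimal tb {f} {i} L fi≢0 =
    subst₂ _≤_ (weight-1-0 f (index L)) (weight-1-0 f i) (Extremal.extremal-minimal tb L fi≢0)

  ν-extremal-strict : ∀ tb {f i} (L : Extremal.ExtremalIndex tb (weight 1 0 f) f) → f i ≢ 0ℤ →
                      i ≢ index L → ¬ TieBreak._⊏_ tb (index L) i → νℤ (f (index L)) < νℤ (f i)
  ν-extremal-strict tb {f} {i} L fi≢0 i≢L L⋢i =
    subst₂ _<_ (weight-1-0 f (index L)) (weight-1-0 f i) (Extremal.extremal-strict tb L fi≢0 i≢L L⋢i)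

  -- For the Newton polygon of H: the right end point is lowest, the points over 0 … n − 2 lie strictly
  -- above it, and the points over 1 … n lie strictly above the line of slope −1/2 through (0, ν H 0).
  record NewtonShape (n : ℕ) (H : ℕ → ℤ) : Set where
    field
      top≢0        : H n ≢ 0ℤ
      vanishes     : VanishesAbove n H
      bottom≢0     : H 0 ≢ 0ℤ
      top-minimal  : ∀ {k} → H k ≢ 0ℤ → νℤ (H n) ≤ νℤ (H k)
      inner-above  : ∀ {k} → k + 2 ≤ n → + (p ^ suc (νℤ (H n))) ∣ℤ H k
      bottom-steep : ∀ {k} → 1 ≤ k → H k ≢ 0ℤ → weight 2 1 H 0 < weight 2 1 H k

  module QuadraticFactor {n d : ℕ} {H A B : ℕ → ℤ} (shape : NewtonShape n H)
                         (A2≢0 : A 2 ≢ 0ℤ) (A↑ : VanishesAbove 2 A) (B↑ : VanishesAbove d B)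
                         (AB≡H : ∀ k → mulCoeffℤ A B k ≡ H k) where
    open NewtonShape shape
    open Extremal using (extremal-exists; extremal-minimal; extremal-strict)

    ∥H : ∀ {e k} → p^ e ∥ ∣ mulCoeffℤ A B k ∣ → p^ e ∥ ∣ H k ∣
    ∥H {e} {k} = subst (λ c → p^ e ∥ ∣ c ∣) (AB≡H k)

    A0≢0 : A 0 ≢ 0ℤ
    A0≢0 A0≡0 = bottom≢0 (trans (sym (AB≡H 0)) (cong (ℤ._* B 0) A0≡0))

    B0≢0 : B 0 ≢ 0ℤ
    B0≢0 B0≡0 = bottom≢0 (trans (sym (AB≡H 0)) (trans (cong (A 0 ℤ.*_) B0≡0) (ℤ.*-zeroʳ (A 0))))

    ν-H0 : νℤ (H 0) ≡ νℤ (A 0) + νℤ (B 0)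
    ν-H0 = trans (cong νℤ (sym (AB≡H 0))) (νℤ-* A0≢0 B0≢0)

    B-degree : ∃[ b ] B b ≢ 0ℤ × VanishesAbove b B
    B-degree with degree-exists d B B↑
    ... | inj₂ deg = deg
    ... | inj₁ B≡0 = ⊥-elim (top≢0 (trans (sym (AB≡H n))
                       (sumToℤ-zero n _ (λ i _ → trans (cong (A i ℤ.*_) (B≡0 _)) (ℤ.*-zeroʳ (A i))))))

    b = proj₁ B-degree
    Bb≢0 = proj₁ (proj₂ B-degree)
    Bb↑ = proj₂ (proj₂ B-degree)

    n≡2+b : n ≡ 2 + b
    n≡2+b = mulCoeffℤ-degree A B H A2≢0 A↑ Bb≢0 Bb↑ AB≡H top≢0 vanishes

    ν-Hn : νℤ (H n) ≡ νℤ (A 2) + νℤ (B b)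
    ν-Hn = begin
      νℤ (H n)               ≡⟨ cong (νℤ ∘ H) n≡2+b ⟩
      νℤ (H (2 + b))         ≡⟨ cong νℤ (sym (AB≡H (2 + b))) ⟩
      νℤ (mulCoeffℤ A B (2 + b)) ≡⟨ cong νℤ (mulCoeffℤ-top A B A↑ Bb↑) ⟩
      νℤ (A 2 ℤ.* B b)       ≡⟨ νℤ-* A2≢0 Bb≢0 ⟩
      νℤ (A 2) + νℤ (B b)    ∎
      where open ≡-Reasoning

    weight-of-product : ∀ k m {i j} → νℤ (H (i + j)) ≡ νℤ (A i) + νℤ (B j) →
                        weight k m H (i + j) ≡ weight k m A i + weight k m B j
    weight-of-product k m {i} {j} ν≡ =
      trans (cong (λ v → k * v + m * (i + j)) ν≡) (sym (weight-sum k m (νℤ (A i)) (νℤ (B j)) i j))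

    halve : ∀ {a b} → 2 * a + 1 * 0 < 2 * b + 1 * 2 → a ≤ b
    halve {a} {b} lt = ≤-pred (*-cancelˡ-< 2 a (suc b)
      (subst₂ _<_ (+-identityʳ (2 * a)) (solve 1 (λ b → con 2 :* b :+ con 1 :* con 2 := con 2 :* (con 1 :+ b)) refl b) lt))
      where open ℕS

    -- The extremal pair for slope −1/2 gives a point of H on or below the line of slope −1/2 through
    -- (0, ν H 0), which bottom-steep only allows at index 0.
    ν-A0≤ν-A2 : νℤ (A 0) ≤ νℤ (A 2)
    ν-A0≤ν-A2 = halve (subst (λ i → weight 2 1 A i < weight 2 1 A 2) i₁≡0
                  (extremal-strict latest LA A2≢0 (λ 2≡i₁ → case trans 2≡i₁ i₁≡0 of λ ())
                                                  (λ 2<i₁ → <⇒≱ 2<i₁ (subst (_≤ 2) (sym i₁≡0) z≤n))))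
      where
      LA = extremal-exists latest (weight 2 1 A) A↑ A2≢0
      LB = extremal-exists latest (weight 2 1 B) Bb↑ Bb≢0
      i₁ = index LA
      j₁ = index LB
      ∥HK : p^ (νℤ (A i₁) + νℤ (B j₁)) ∥ ∣ H (i₁ + j₁) ∣
      ∥HK = ∥H (extremal-∥ latest 2 1 A B LA LB)
      weight-HK≤ : weight 2 1 H (i₁ + j₁) ≤ weight 2 1 H 0
      weight-HK≤ = begin
        weight 2 1 H (i₁ + j₁)                 ≡⟨ weight-of-product 2 1 (ν-unique ∥HK) ⟩
        weight 2 1 A i₁ + weight 2 1 B j₁      ≤⟨ +-mono-≤ (extremal-minimal latest LA A0≢0) (extremal-minimal latest LB B0≢0) ⟩
        weight 2 1 A 0 + weight 2 1 B 0        ≡⟨ weight-of-product 2 1 ν-H0 ⟨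
        weight 2 1 H 0                         ∎
        where open ≤-Reasoning
      i₁≡0 : i₁ ≡ 0
      i₁≡0 = m+n≡0⇒m≡0 i₁ (n≤0⇒n≡0 (≮⇒≥ λ 0<K → <⇒≱ (bottom-steep 0<K (∥⇒≢0 ∥HK ∘ cong ∣_∣)) weight-HK≤))

    -- A latest ν-minimal coefficient of A before index 2 would give a point of H below (n, ν H n).
    ν-A2-minimal : ∀ {i} → A i ≢ 0ℤ → νℤ (A 2) ≤ νℤ (A i)
    ν-A2-minimal {i} Ai≢0 = subst (λ c → νℤ (A c) ≤ νℤ (A i)) c≡2 (ν-extremal-minimal latest LA Ai≢0)
      where
      LA = extremal-exists latest (weight 1 0 A) A↑ A2≢0
      LB = extremal-exists latest (weight 1 0 B) Bb↑ Bb≢0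
      c = index LA
      c≡2 : c ≡ 2
      c≡2 with <-cmp c 2
      ... | tri≈ _ c≡2 _ = c≡2
      ... | tri> _ _ 2<c = ⊥-elim (<⇒≱ 2<c (≢0⇒≤ A↑ (holds LA)))
      ... | tri< c<2 _ _ = ⊥-elim (<⇒≱ νHK<νHn (top-minimal (∥⇒≢0 ∥HK ∘ cong ∣_∣)))
        where
        ∥HK = ∥H (extremal-∥ latest 1 0 A B LA LB)
        νHK<νHn : νℤ (H (c + index LB)) < νℤ (H n)
        νHK<νHn = subst₂ _<_ (sym (ν-unique ∥HK)) (sym ν-Hn)
          (+-mono-<-≤ (ν-extremal-strict latest LA A2≢0 (<⇒≢ c<2 ∘ sym) (<⇒≯ c<2)) (ν-extremal-minimal latest LB Bb≢0))

    -- If the earliest ν-minimal coefficient of A were at index 0, the earliest ν-minimal ones of A and B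
    -- would give a coefficient of H of index at most n − 2 not divisible by p ^ (ν H n + 1).
    absurd : ⊥
    absurd = <-irrefl refl (begin-strict
      νℤ (A s)   <⟨ ν-extremal-strict earliest LA A0≢0 (s≢0 ∘ sym) (λ ()) ⟩
      νℤ (A 0)   ≤⟨ ν-A0≤ν-A2 ⟩
      νℤ (A 2)   ≤⟨ ν-A2-minimal (holds LA) ⟩
      νℤ (A s)   ∎)
      where
      open ≤-Reasoning
      LA = extremal-exists earliest (weight 1 0 A) A↑ A2≢0
      LB = extremal-exists earliest (weight 1 0 B) Bb↑ Bb≢0
      s = index LA
      t = index LB
      s≢0 : s ≢ 0
      s≢0 s≡0 = <⇒≱ (∥-greatest ∥HK (ℤ∣.∣⇒∣ᵤ (inner-above K+2≤n))) νHK≤νHn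
        where
        ∥HK = ∥H (extremal-∥ earliest 1 0 A B LA LB)
        K+2≤n : s + t + 2 ≤ n
        K+2≤n = subst₂ (λ s′ n′ → s′ + t + 2 ≤ n′) (sym s≡0) (trans (+-comm b 2) (sym n≡2+b))
                  (+-monoˡ-≤ 2 (≢0⇒≤ Bb↑ (holds LB)))
        νHK≤νHn : νℤ (A s) + νℤ (B t) ≤ νℤ (H n)
        νHK≤νHn = subst (νℤ (A s) + νℤ (B t) ≤_) (sym ν-Hn)
                    (+-mono-≤ (ν-extremal-minimal earliest LA A2≢0) (ν-extremal-minimal earliest LB Bb≢0))

  no-quadratic-factor : ∀ {n d H} A B → NewtonShape n H → A 2 ≢ 0ℤ → VanishesAbove 2 A → VanishesAbove d B →
                        (∀ k → mulCoeffℤ A B k ≡ H k) → ⊥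
  no-quadratic-factor A B shape A2≢0 A↑ B↑ AB≡H = QuadraticFactor.absurd shape A2≢0 A↑ B↑ AB≡H

  NewtonShape-scale : ∀ {n c} D → D ≢ 0 → NewtonShape n c → NewtonShape n (λ k → + D ℤ.* c k)
  NewtonShape-scale {n} {c} D D≢0 shape = record
    { top≢0        = *-≢0ℤ +D≢0 top≢0
    ; vanishes     = λ k n<k → trans (cong (+ D ℤ.*_) (vanishes k n<k)) (ℤ.*-zeroʳ (+ D))
    ; bottom≢0     = *-≢0ℤ +D≢0 bottom≢0
    ; top-minimal  = λ Dck≢0 → subst₂ _≤_ (sym (ν-D* top≢0)) (sym (ν-D* (factor≢0 Dck≢0)))
                                 (+-monoʳ-≤ (ν D) (top-minimal (factor≢0 Dck≢0)))
    ; inner-above  = λ {k} k+2≤n → ℤ∣.∣ᵤ⇒∣ (subst₂ _∣_ (p^ν-D* top≢0) (sym (ℤ.abs-* (+ D) (c k)))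
                                   (*-pres-∣ (∥⇒∣ (ν-∥ D≢0)) (ℤ∣.∣⇒∣ᵤ (inner-above k+2≤n))))
    ; bottom-steep = λ {k} 1≤k Dck≢0 → subst₂ _<_ (sym (weight-D* bottom≢0 0)) (sym (weight-D* (factor≢0 Dck≢0) k))
                                         (+-monoʳ-< (2 * ν D) (bottom-steep 1≤k (factor≢0 Dck≢0)))
    }
    where
    open NewtonShape shape
    +D≢0 : + D ≢ 0ℤ
    +D≢0 = D≢0 ∘ ℤ.+-injective
    factor≢0 : ∀ {x} → + D ℤ.* x ≢ 0ℤ → x ≢ 0ℤ
    factor≢0 Dx≢0 x≡0 = Dx≢0 (trans (cong (+ D ℤ.*_) x≡0) (ℤ.*-zeroʳ (+ D)))
    ν-D* : ∀ {x} → x ≢ 0ℤ → νℤ (+ D ℤ.* x) ≡ ν D + νℤ x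
    ν-D* = νℤ-* +D≢0
    p^ν-D* : ∀ {x} → x ≢ 0ℤ → p ^ ν D * p ^ suc (νℤ x) ≡ p ^ suc (νℤ (+ D ℤ.* x))
    p^ν-D* {x} x≢0 = trans (sym (^-distribˡ-+-* p (ν D) (suc (νℤ x))))
                           (cong (p ^_) (trans (+-suc (ν D) (νℤ x)) (cong suc (sym (ν-D* x≢0)))))
    weight-D* : ∀ {x} → x ≢ 0ℤ → ∀ k → weight 2 1 (λ _ → + D ℤ.* x) k ≡ 2 * ν D + weight 2 1 (λ _ → x) k
    weight-D* {x} x≢0 k = trans (cong (λ v → 2 * v + 1 * k) (ν-D* x≢0))
      (solve 3 (λ d v k → con 2 :* (d :+ v) :+ con 1 :* k := con 2 :* d :+ (con 2 :* v :+ con 1 :* k)) refl (ν D) (νℤ x) k)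
      where open ℕS

-- Clearing denominators

-- Written with mkℚ instead of z / 1 so that ↥ (ι z) and toℚᵘ (ι z) compute.
ι : ℤ → ℚ
ι z = mkℚ z 0 (Coprime.sym (Coprime.1-coprimeTo ∣ z ∣))

ι-injective : ∀ {x y} → ι x ≡ ι y → x ≡ y
ι-injective = cong ↥_

ι-+ : ∀ x y → ι (x ℤ.+ y) ≡ ι x ℚ.+ ι y
ι-+ x y = ℚ.toℚᵘ-injective (ℚᵘ.≃-sym (ℚᵘ.≃-trans (ℚ.toℚᵘ-homo-+ (ι x) (ι y))
  (ℚᵘ.*≡* (ℤS.solve 2 (λ x y → (x :* con (+ 1) :+ y :* con (+ 1)) :* con (+ 1) := (x :+ y) :* con (+ 1)) refl x y))))
  where open ℤS

ι-* : ∀ x y → ι (x ℤ.* y) ≡ ι x ℚ.* ι y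
ι-* x y = ℚ.toℚᵘ-injective (ℚᵘ.≃-sym (ℚᵘ.≃-trans (ℚ.toℚᵘ-homo-* (ι x) (ι y))
  (ℚᵘ.*≡* refl)))

ι-↥ : ∀ t q → ι (+ t ℤ.* ↥ q) ≡ ι (+ (t * ↧ₙ q)) ℚ.* q
ι-↥ t q@(mkℚ n d-1 _) = ℚ.toℚᵘ-injective (ℚᵘ.≃-sym (ℚᵘ.≃-trans (ℚ.toℚᵘ-homo-* (ι (+ (t * suc d-1))) q) (ℚᵘ.*≡* (begin
  + (t * suc d-1) ℤ.* n ℤ.* + 1     ≡⟨ cong (λ x → x ℤ.* n ℤ.* + 1) (ℤ.pos-* t (suc d-1)) ⟩
  + t ℤ.* + suc d-1 ℤ.* n ℤ.* + 1   ≡⟨ ℤS.solve 3 (λ t d n → t :* d :* n :* con (+ 1) := t :* n :* d) refl (+ t) (+ suc d-1) n ⟩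
  + t ℤ.* n ℤ.* + suc d-1           ≡⟨ cong (λ x → + t ℤ.* n ℤ.* + x) (*-identityˡ (suc d-1)) ⟨
  + t ℤ.* n ℤ.* + (1 * suc d-1)     ∎))))
  where
  open ≡-Reasoning
  open ℤS using (_:*_; _:=_; con)

ι-*-/ : ∀ z m t .{{_ : NonZero m}} → ι (+ (m * t)) ℚ.* (z ℚ./ m) ≡ ι (z ℤ.* + t)
ι-*-/ z (suc m) t = ℚ.toℚᵘ-injective (ℚᵘ.≃-trans (ℚ.toℚᵘ-homo-* (ι (+ (suc m * t))) (z ℚ./ suc m))
  (ℚᵘ.≃-trans (ℚᵘ.*-congˡ {toℚᵘ (ι (+ (suc m * t)))} (ℚ.toℚᵘ-fromℚᵘ (ℚᵘ.mkℚᵘ z m))) (ℚᵘ.*≡* (begin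
    + (suc m * t) ℤ.* z ℤ.* + 1       ≡⟨ cong (λ x → x ℤ.* z ℤ.* + 1) (ℤ.pos-* (suc m) t) ⟩
    + suc m ℤ.* + t ℤ.* z ℤ.* + 1     ≡⟨ ℤS.solve 3 (λ m t z → m :* t :* z :* con (+ 1) := z :* t :* m) refl (+ suc m) (+ t) z ⟩
    z ℤ.* + t ℤ.* + suc m             ≡⟨ cong (λ x → z ℤ.* + t ℤ.* + x) (*-identityˡ (suc m)) ⟨
    z ℤ.* + t ℤ.* + (1 * suc m)       ∎))))
  where
  open ≡-Reasoning
  open ℤS using (_:*_; _:=_; con)

ι-*-≡0 : ∀ m q → ι (+ suc m) ℚ.* q ≡ 0ℚ → q ≡ 0ℚ
ι-*-≡0 m q c*q≡0 = begin
  q                        ≡⟨ ℚ.*-identityˡ q ⟨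
  1ℚ ℚ.* q                 ≡⟨ cong (ℚ._* q) (ℚ.*-inverseˡ c) ⟨
  ℚ.1/ c ℚ.* c ℚ.* q       ≡⟨ ℚ.*-assoc (ℚ.1/ c) c q ⟩
  ℚ.1/ c ℚ.* (c ℚ.* q)     ≡⟨ cong (ℚ.1/ c ℚ.*_) c*q≡0 ⟩
  ℚ.1/ c ℚ.* 0ℚ            ≡⟨ ℚ.*-zeroʳ (ℚ.1/ c) ⟩
  0ℚ                       ∎
  where
  open ≡-Reasoning
  c = ι (+ suc m)

ι-sumToℤ : ∀ k f → ι (sumToℤ k f) ≡ sumTo k (ι ∘ f)
ι-sumToℤ zero f = refl
ι-sumToℤ (suc k) f = trans (ι-+ (sumToℤ k f) (f (suc k))) (cong (ℚ._+ ι (f (suc k))) (ι-sumToℤ k f))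

sumTo-cong : ∀ k {f g} → (∀ i → f i ≡ g i) → sumTo k f ≡ sumTo k g
sumTo-cong zero f≡g = f≡g 0
sumTo-cong (suc k) f≡g = cong₂ ℚ._+_ (sumTo-cong k f≡g) (f≡g (suc k))

sumTo-*ˡ : ∀ k c f → sumTo k (λ i → c ℚ.* f i) ≡ c ℚ.* sumTo k f
sumTo-*ˡ zero c f = refl
sumTo-*ˡ (suc k) c f = trans (cong (ℚ._+ c ℚ.* f (suc k)) (sumTo-*ˡ k c f)) (sym (ℚ.*-distribˡ-+ c (sumTo k f) (f (suc k))))

denominators : (ℕ → ℚ) → ℕ → ℕ
denominators f zero    = ↧ₙ f 0
denominators f (suc d) = denominators f d * ↧ₙ f (suc d)


denominators≢0 : ∀ f d → denominators f d ≢ 0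
denominators≢0 f zero    ()
denominators≢0 f (suc d) = *-≢0ℕ (denominators≢0 f d) λ ()

↧∣denominators : ∀ f d → (∀ k → d < k → f k ≡ 0ℚ) → ∀ i → ↧ₙ f i ∣ denominators f d
↧∣denominators f d f↑ i with i ≤? d
... | yes i≤d = below d i≤d
  where
  below : ∀ d {i} → i ≤ d → ↧ₙ f i ∣ denominators f d
  below zero    z≤n = ∣-refl
  below (suc d) i≤ with ≤-suc-cases i≤
  ... | inj₁ refl = n∣m*n (denominators f d)
  ... | inj₂ i≤d = ∣m⇒∣m*n (↧ₙ f (suc d)) (below d i≤d)
... | no i≰d = subst (λ q → ↧ₙ q ∣ denominators f d) (sym (f↑ i (≰⇒> i≰d))) (1∣ denominators f d)

-- D · f i, as an integer when the denominator of f i divides D (the division is truncating).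
integralMultiple : ℕ → (ℕ → ℚ) → ℕ → ℤ
integralMultiple D f i = + (D / ↧ₙ f i) ℤ.* ↥ f i

ι-integralMultiple : ∀ D f i → ↧ₙ f i ∣ D → ι (integralMultiple D f i) ≡ ι (+ D) ℚ.* f i
ι-integralMultiple D f i ↧∣D = trans (ι-↥ (D / ↧ₙ f i) (f i)) (cong (λ m → ι (+ m) ℚ.* f i) (m/n*n≡m ↧∣D))

integralMultiple-≡0 : ∀ D f {i} → f i ≡ 0ℚ → integralMultiple D f i ≡ 0ℤ
integralMultiple-≡0 D f {i} fi≡0 = trans (cong (λ q → + (D / ↧ₙ q) ℤ.* ↥ q) fi≡0) (ℤ.*-zeroʳ (+ (D / 1)))

integralMultiple-≢0 : ∀ D f {i} → D ≢ 0 → ↧ₙ f i ∣ D → f i ≢ 0ℚ → integralMultiple D f i ≢ 0ℤ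
integralMultiple-≢0 zero    f D≢0 _ _ _ = D≢0 refl
integralMultiple-≢0 (suc D) f {i} _ ↧∣D fi≢0 ≡0 =
  fi≢0 (ι-*-≡0 D (f i) (trans (sym (ι-integralMultiple (suc D) f i ↧∣D)) (cong ι ≡0)))

ι-+* : ∀ a b → ι (+ (a * b)) ≡ ι (+ a) ℚ.* ι (+ b)
ι-+* a b = trans (cong ι (ℤ.pos-* a b)) (ι-* (+ a) (+ b))

mulCoeffℤ-integral : ∀ {A B A′ B′ a b} →
                     (∀ i → ι (A′ i) ≡ ι (+ a) ℚ.* A i) → (∀ i → ι (B′ i) ≡ ι (+ b) ℚ.* B i) →
                     ∀ k → ι (mulCoeffℤ A′ B′ k) ≡ ι (+ (a * b)) ℚ.* mulCoeff A B k
mulCoeffℤ-integral {A} {B} {A′} {B′} {a} {b} ιA′ ιB′ k = begin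
  ι (mulCoeffℤ A′ B′ k)                                    ≡⟨ ι-sumToℤ k _ ⟩
  sumTo k (λ i → ι (A′ i ℤ.* B′ (k ∸ i)))                 ≡⟨ sumTo-cong k term ⟩
  sumTo k (λ i → ι (+ (a * b)) ℚ.* (A i ℚ.* B (k ∸ i)))   ≡⟨ sumTo-*ˡ k (ι (+ (a * b))) _ ⟩
  ι (+ (a * b)) ℚ.* mulCoeff A B k                         ∎
  where
  open ≡-Reasoning
  term : ∀ i → ι (A′ i ℤ.* B′ (k ∸ i)) ≡ ι (+ (a * b)) ℚ.* (A i ℚ.* B (k ∸ i))
  term i = begin
    ι (A′ i ℤ.* B′ (k ∸ i))                                ≡⟨ ι-* (A′ i) (B′ (k ∸ i)) ⟩
    ι (A′ i) ℚ.* ι (B′ (k ∸ i))                            ≡⟨ cong₂ ℚ._*_ (ιA′ i) (ιB′ (k ∸ i)) ⟩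
    (ι (+ a) ℚ.* A i) ℚ.* (ι (+ b) ℚ.* B (k ∸ i))          ≡⟨ ℚS.solve 4 (λ x u y v → (x :* u) :* (y :* v) := (x :* y) :* (u :* v))
                                                                        refl (ι (+ a)) (A i) (ι (+ b)) (B (k ∸ i)) ⟩
    (ι (+ a) ℚ.* ι (+ b)) ℚ.* (A i ℚ.* B (k ∸ i))          ≡⟨ cong (ℚ._* (A i ℚ.* B (k ∸ i))) (ι-+* a b) ⟨
    ι (+ (a * b)) ℚ.* (A i ℚ.* B (k ∸ i))                  ∎
    where
    open ℚS using (_:*_; _:=_)

module RationalFactors {p : ℕ} (p-prime : Prime p) where
  open Valuation p-prime
  open Newton p-prime

  no-quadratic-factor-ℚ : ∀ {n G c} M → M ≢ 0 → NewtonShape n c → (∀ k → ι (c k) ≡ ι (+ M) ℚ.* G k) →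
                          ¬ HasQuadFactor G
  no-quadratic-factor-ℚ {n} {G} {c} M M≢0 shape ιc (A , (A2≢0 , A↑) , B , (d , B↑) , AB≡G) =
    no-quadratic-factor A′ B′ (NewtonShape-scale D D≢0 shape) A′2≢0 A′↑ B′↑ A′B′≡Dc
    where
    DA = denominators A 2
    DB = denominators B d
    D = DA * DB
    D≢0 : D ≢ 0
    D≢0 = *-≢0ℕ (denominators≢0 A 2) (denominators≢0 B d)
    ↧A∣ : ∀ i → ↧ₙ A i ∣ M * DA
    ↧A∣ i = ∣n⇒∣m*n M (↧∣denominators A 2 A↑ i)
    A′ = integralMultiple (M * DA) A
    B′ = integralMultiple DB B
    A′2≢0 : A′ 2 ≢ 0ℤ
    A′2≢0 = integralMultiple-≢0 (M * DA) A (*-≢0ℕ M≢0 (denominators≢0 A 2)) (↧A∣ 2) A2≢0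
    A′↑ : VanishesAbove 2 A′
    A′↑ k 2<k = integralMultiple-≡0 (M * DA) A (A↑ k 2<k)
    B′↑ : VanishesAbove d B′
    B′↑ k d<k = integralMultiple-≡0 DB B (B↑ k d<k)
    A′B′≡Dc : ∀ k → mulCoeffℤ A′ B′ k ≡ + D ℤ.* c k
    A′B′≡Dc k = ι-injective (begin
      ι (mulCoeffℤ A′ B′ k)                  ≡⟨ mulCoeffℤ-integral {A} {B} {a = M * DA} {DB} (λ i → ι-integralMultiple (M * DA) A i (↧A∣ i))
                                                                  (λ i → ι-integralMultiple DB B i (↧∣denominators B d B↑ i)) k ⟩
      ι (+ (M * DA * DB)) ℚ.* mulCoeff A B k  ≡⟨ cong₂ ℚ._*_ (cong (ι ∘ +_) (solve 3 (λ m a b → m :* a :* b := a :* b :* m) refl M DA DB)) (AB≡G k) ⟩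
      ι (+ (D * M)) ℚ.* G k                   ≡⟨ cong (ℚ._* G k) (ι-+* D M) ⟩
      ι (+ D) ℚ.* ι (+ M) ℚ.* G k             ≡⟨ ℚ.*-assoc (ι (+ D)) (ι (+ M)) (G k) ⟩
      ι (+ D) ℚ.* (ι (+ M) ℚ.* G k)           ≡⟨ cong (ι (+ D) ℚ.*_) (ιc k) ⟨
      ι (+ D) ℚ.* ι (c k)                     ≡⟨ ι-* (+ D) (c k) ⟨
      ι (+ D ℤ.* c k)                         ∎)
      where
      open ≡-Reasoning
      open ℕS

-- The polynomial n! G

scaledG : ℕ → ℕ → (ℕ → ℤ) → ℕ → ℤ
scaledG n s b j with j <? suc n
... | yes _ = b j ℤ.* + (aCoeff n s j * rising j (n ∸ j))
... | no _  = 0ℤ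

scaledG-≤ : ∀ n s b {j} → j ≤ n → scaledG n s b j ≡ b j ℤ.* + (aCoeff n s j * rising j (n ∸ j))
scaledG-≤ n s b {j} j≤n with j <? suc n
... | yes _ = refl
... | no j≮1+n = ⊥-elim (j≮1+n (s≤s j≤n))

scaledG-> : ∀ n s b → VanishesAbove n (scaledG n s b)
scaledG-> n s b j n<j with j <? suc n
... | yes j<1+n = ⊥-elim (<⇒≱ n<j (≤-pred j<1+n))
... | no _ = refl

ι-scaledG : ∀ n s b j → ι (scaledG n s b j) ≡ ι (+ (n !)) ℚ.* Gpoly n s b j
ι-scaledG n s b j with j <? suc n
... | no _ = sym (ℚ.*-zeroʳ (ι (+ (n !))))
... | yes j<1+n = begin
  ι (b j ℤ.* + (a * r))                                ≡⟨ cong ι (trans (cong (b j ℤ.*_) (ℤ.pos-* a r)) (sym (ℤ.*-assoc (b j) (+ a) (+ r)))) ⟩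
  ι (b j ℤ.* + a ℤ.* + r)                              ≡⟨ ι-*-/ (b j ℤ.* + a) (j !) r {{j !≢0}} ⟨
  ι (+ (j ! * r)) ℚ.* ((b j ℤ.* + a) ℚ./ j !) {{j !≢0}} ≡⟨ cong (λ m → ι (+ m) ℚ.* ((b j ℤ.* + a) ℚ./ j !) {{j !≢0}}) j!*r≡n! ⟩
  ι (+ (n !)) ℚ.* ((b j ℤ.* + a) ℚ./ j !) {{j !≢0}}    ∎
  where
  open ≡-Reasoning
  a = aCoeff n s j
  r = rising j (n ∸ j)
  j!*r≡n! : j ! * r ≡ n !
  j!*r≡n! = trans (!*rising≡! j (n ∸ j)) (cong _! (m+[n∸m]≡n (≤-pred j<1+n)))

module ScaledG {p : ℕ} (p-prime : Prime p) (3≤p : 3 ≤ p) {n s δ r : ℕ} {b : ℕ → ℤ}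
               (∣b0∣≡1 : ∣ b 0 ∣ ≡ 1) (∣bn∣≡1 : ∣ b n ∣ ≡ 1) (δ≤1 : δ ≤ 1) (δ≤n : δ ≤ n)
               (0<r : 0 < r) (p^r∣n∸δ : p ^ r ∣ n ∸ δ) (p∤1+s : δ ≡ 1 → p ∤ suc s) (s+δ<p^r : s + δ < p ^ r) where
  open Valuation p-prime
  open FactorialValuation p-prime
  open Newton p-prime

  c : ℕ → ℤ
  c = scaledG n s b

  ∣c∣ : ∀ {k} → k ≤ n → ∣ c k ∣ ≡ ∣ b k ∣ * (aCoeff n s k * rising k (n ∸ k))
  ∣c∣ {k} k≤n = trans (cong ∣_∣ (scaledG-≤ n s b k≤n)) (ℤ.abs-* (b k) _)

  ∣c-top∣ : ∣ c n ∣ ≡ 1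
  ∣c-top∣ = trans (∣c∣ ≤-refl) (cong₂ (λ x m → x * (((n + s ∸ n) C m) * rising n m)) ∣bn∣≡1 (n∸n≡0 n))

  X = aCoeff n s 0

  p∤X : p ∤ X
  p∤X = subst (λ m → p ∤ (m + s) C m) (m∸n+n≡m δ≤n) (∤-binomial {r} δ s p^r∣n∸δ δ≤1 s+δ<p^r p∤1+s)

  X≢0 : X ≢ 0
  X≢0 X≡0 = p∤X (subst (p ∣_) (sym X≡0) (p ∣0))

  ∣c-bottom∣ : ∣ c 0 ∣ ≡ X * n !
  ∣c-bottom∣ = trans (∣c∣ z≤n) (trans (cong₂ (λ x m → x * (X * m)) ∣b0∣≡1 rising-0) (*-identityˡ (X * n !)))
    where
    rising-0 : rising 0 n ≡ n !
    rising-0 = trans (sym (+-identityʳ (rising 0 n))) (!*rising≡! 0 n)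

  ν-c-top : νℤ (c n) ≡ 0
  ν-c-top = trans (cong ν ∣c-top∣) ν-1

  ν-c-bottom : νℤ (c 0) ≡ ν (n !)
  ν-c-bottom = trans (cong ν ∣c-bottom∣) (trans (ν-* X≢0 (!-≢0 n)) (cong (_+ ν (n !)) (ν-∤ p∤X)))

  rising∣c : ∀ {k} → k ≤ n → rising k (n ∸ k) ∣ ∣ c k ∣
  rising∣c {k} k≤n = subst (rising k (n ∸ k) ∣_) (sym (∣c∣ k≤n)) (∣n⇒∣m*n ∣ b k ∣ (n∣m*n (aCoeff n s k)))

  p∣rising : ∀ {k} → k + 2 ≤ n → p ∣ rising k (n ∸ k)
  p∣rising {k} k+2≤n = ∣-trans p∣n∸δ (subst (_∣ rising k (n ∸ k)) (m+[n∸m]≡n (<⇒≤ k<n∸δ))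
                         (+∣rising k (m<n⇒0<n∸m k<n∸δ) (∸-monoˡ-≤ k (m∸n≤m n δ))))
    where
    k<n∸δ : k < n ∸ δ
    k<n∸δ = subst (_≤ n ∸ δ) (trans (+-∸-assoc k {2} {1} (s≤s z≤n)) (+-comm k 1)) (∸-mono k+2≤n δ≤1)
    p∣n∸δ : p ∣ n ∸ δ
    p∣n∸δ = ∣-trans (subst (_∣ p ^ r) (*-identityʳ p) (^-monoʳ-∣ 0<r)) p^r∣n∸δ

  bottom-steep : ∀ {k} → 1 ≤ k → c k ≢ 0ℤ → weight 2 1 c 0 < weight 2 1 c k
  bottom-steep {k} 1≤k ck≢0 = begin-strict
    2 * νℤ (c 0) + 1 * 0               ≡⟨ trans (+-identityʳ _) (cong (2 *_) ν-c-bottom) ⟩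
    2 * ν (n !)                        ≡⟨ cong (λ m → 2 * ν m) k!*R≡n! ⟨
    2 * ν (k ! * R)                    ≡⟨ cong (2 *_) (ν-* (!-≢0 k) (rising≢0 k (n ∸ k))) ⟩
    2 * (ν (k !) + ν R)                ≡⟨ *-distribˡ-+ 2 (ν (k !)) (ν R) ⟩
    2 * ν (k !) + 2 * ν R              <⟨ +-monoˡ-< (2 * ν R) (2*ν-!< 3≤p k 1≤k) ⟩
    k + 2 * ν R                        ≤⟨ +-monoʳ-≤ k (*-monoʳ-≤ 2 (∣⇒ν≤ (i≢0⇒∣i∣≢0 ck≢0) (rising∣c k≤n))) ⟩
    k + 2 * νℤ (c k)                   ≡⟨ trans (cong (λ m → 2 * νℤ (c k) + m) (*-identityˡ k)) (+-comm (2 * νℤ (c k)) k) ⟨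
    2 * νℤ (c k) + 1 * k               ∎
    where
    open ≤-Reasoning
    R = rising k (n ∸ k)
    k≤n : k ≤ n
    k≤n = ≢0⇒≤ {f = c} (scaledG-> n s b) ck≢0
    k!*R≡n! : k ! * R ≡ n !
    k!*R≡n! = trans (!*rising≡! k (n ∸ k)) (cong _! (m+[n∸m]≡n k≤n))

  shape : NewtonShape n c
  shape = record
    { top≢0        = λ cn≡0 → 1+n≢0 (trans (sym ∣c-top∣) (cong ∣_∣ cn≡0))
    ; vanishes     = scaledG-> n s b
    ; bottom≢0     = λ c0≡0 → *-≢0ℕ X≢0 (!-≢0 n) (trans (sym ∣c-bottom∣) (cong ∣_∣ c0≡0))
    ; top-minimal  = λ {k} _ → subst (_≤ νℤ (c k)) (sym ν-c-top) z≤n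
    ; inner-above  = λ {k} k+2≤n → ℤ∣.∣ᵤ⇒∣ (subst (λ e → p ^ suc e ∣ ∣ c k ∣) (sym ν-c-top)
                       (∣-trans (subst (_∣ p) (sym (*-identityʳ p)) ∣-refl)
                         (∣-trans (p∣rising k+2≤n) (rising∣c (≤-trans (m≤m+n k 2) k+2≤n)))))
    ; bottom-steep = bottom-steep
    }

lemma2p11 : (n s : ℕ) → 1 ≤ n → (b : ℕ → ℤ) → ∣ b 0 ∣ ≡ 1 → ∣ b n ∣ ≡ 1 →
    HasQuadFactor (Gpoly n s b) →
    (δ r p : ℕ) → δ ≤ 1 → 0 < r → Prime p → 2 < p → (p ^ r) ∣ (n ∸ δ) →
    (δ ≡ 1 → gcd (s + 1) p ≡ 1) →
    s ≥ p ^ r ∸ δ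
lemma2p11 n s 1≤n b ∣b0∣≡1 ∣bn∣≡1 quadratic δ r p δ≤1 0<r p-prime 2<p p^r∣n∸δ coprime with p ^ r ∸ δ ≤? s
... | yes p^r∸δ≤s = p^r∸δ≤s
... | no p^r∸δ≰s = ⊥-elim (no-quadratic-factor-ℚ (n !) (!-≢0 n) shape (ι-scaledG n s b) quadratic)
  where
  open Valuation p-prime using (gcd≡1⇒∤)
  open RationalFactors p-prime
  s+δ<p^r : s + δ < p ^ r
  s+δ<p^r = subst (s + δ <_) (m∸n+n≡m (≤-trans δ≤1 (m^n>0 p {{prime⇒nonZero p-prime}} r))) (+-monoˡ-< δ (≰⇒> p^r∸δ≰s))
  p∤1+s : δ ≡ 1 → p ∤ suc s
  p∤1+s δ≡1 = gcd≡1⇒∤ (trans (cong (λ m → gcd m p) (+-comm 1 s)) (coprime δ≡1))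
  open ScaledG p-prime 2<p {b = b} ∣b0∣≡1 ∣bn∣≡1 δ≤1 (≤-trans δ≤1 1≤n) 0<r p^r∣n∸δ p∤1+s s+δ<p^r using (shape)
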